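{- Let $s\ge 1$ and let $\alpha = 0^s\beta$ be a symmetric bracelet, where the binary string $\beta$ begins and ends with $1$ and does not contain $0^s$ as a substring. Then $\beta$ is a palindrome, i.e. $\beta=\beta^R$.
   Context: Binary strings are compared lexicographically with $0<1$ (a proper prefix is smaller). For $\alpha=a_1\cdots a_n$, $\alpha^R=a_n\cdots a_1$. $[\alpha]$ is the set of rotations of $\alpha$; $\alpha$ is a necklace if it is lexicographically smallest in $[\alpha]$, and a bracelet if it is lexicographically smallest in $[\alpha]\cup[\alpha^R]$. A necklace $\alpha$ is symmetric if $\alpha^R \in [\alpha]$. $0^s$ denotes $s$ copies of $0$. -}

module Defs where

open import Data.Bool using (Bool; false; true)
open import Data.Nat using (ℕ; _<_)
open import Data.List using (List; []; _∷_; _++_; drop; take; reverse; length; replicate)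
open import Data.Product using (Σ; ∃; ∃-syntax; _×_)
open import Data.Sum using (_⊎_)
open import Relation.Binary.PropositionalEquality using (_≡_)

-- Binary strings: 0 is false, 1 is true.
Bit : Set
Bit = Bool

Str : Set
Str = List Bit

data _<ᵇ_ : Bit → Bit → Set where
  0<1 : false <ᵇ true

data _≤ₗ_ : Str → Str → Set where
  []≤    : ∀ {ys} → [] ≤ₗ ys
  lt≤    : ∀ {x y xs ys} → x <ᵇ y → (x ∷ xs) ≤ₗ (y ∷ ys)
  eq≤    : ∀ {x xs ys} → xs ≤ₗ ys → (x ∷ xs) ≤ₗ (x ∷ ys)

rotate : ℕ → Str → Str
rotate k α = drop k α ++ take k α

_∈Rot_ : Str → Str → Set
β ∈Rot α = ∃[ k ] (k < length α × β ≡ rotate k α)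

Necklace : Str → Set
Necklace α = ∀ β → β ∈Rot α → α ≤ₗ β

Bracelet : Str → Set
Bracelet α = ∀ β → (β ∈Rot α ⊎ β ∈Rot reverse α) → α ≤ₗ β

SymmetricNecklace : Str → Set
SymmetricNecklace α = Necklace α × reverse α ∈Rot α

_SubstringOf_ : Str → Str → Set
p SubstringOf w = ∃[ u ] ∃[ v ] (w ≡ u ++ p ++ v)

BeginsWith1 : Str → Set
BeginsWith1 β = ∃[ γ ] (β ≡ true ∷ γ)

EndsWith1 : Str → Set
EndsWith1 β = ∃[ γ ] (β ≡ γ ++ (true ∷ []))

zeros : ℕ → Str
zeros s = replicate s false

-- Write α^R = β^R 0^s as the rotation of α = 0^s β starting at position k. If k < s the rotation
-- begins with 0, while β^R begins with 1. If k = s then β^R 0^s = β 0^s, so β = β^R. If k = s + j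
-- with j ≥ 1 then β^R 0^s = v 0^s u where u, the first j letters of β, begins with 1; reversing,
-- 0^s β = u^R 0^s v^R with u^R ending in 1; that 1 lies inside β, hence so does the block 0^s after it.
module Submission where

open import Defs
open import Data.Bool using (true; false)
open import Data.Empty using (⊥-elim)
open import Data.List using (List; []; _∷_; _++_; [_]; reverse; replicate; take; drop; length)
open import Data.List.Properties
  using (∷-injectiveˡ; ∷-injectiveʳ; ++-assoc; ++-identityʳ; ++-cancelʳ; reverse-++; reverse-involutive; unfold-reverse; length-replicate)
open import Data.Nat using (ℕ; zero; suc; _+_; _<_; _≥_; s≤s)
open import Data.Nat.Properties using (_<?_; ≮⇒≥; m≤n⇒∃[o]m+o≡n)
open import Data.Product using (_,_; ∃-syntax)
open import Relation.Nullary using (¬_; yes; no)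
open import Relation.Binary.PropositionalEquality hiding ([_])
open ≡-Reasoning

private
  variable
    A : Set

reverse-replicate : ∀ n (a : A) → reverse (replicate n a) ≡ replicate n a
reverse-replicate zero    a = refl
reverse-replicate (suc n) a = begin
  reverse (a ∷ replicate n a)     ≡⟨ unfold-reverse a (replicate n a) ⟩
  reverse (replicate n a) ++ [ a ] ≡⟨ cong (_++ [ a ]) (reverse-replicate n a) ⟩
  replicate n a ++ [ a ]           ≡⟨ replicate-∷ʳ n ⟩
  a ∷ replicate n a                ∎
  where
  replicate-∷ʳ : ∀ n → replicate n a ++ [ a ] ≡ a ∷ replicate n a
  replicate-∷ʳ zero    = refl
  replicate-∷ʳ (suc n) = cong (a ∷_) (replicate-∷ʳ n)

drop-replicate-++ : ∀ {k n} (a : A) (ys : List A) → k < n →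
                    ∃[ ws ] drop k (replicate n a ++ ys) ≡ a ∷ ws
drop-replicate-++ {k = zero}  {suc n} a ys _         = replicate n a ++ ys , refl
drop-replicate-++ {k = suc k} {suc n} a ys (s≤s k<n) = drop-replicate-++ a ys k<n

drop-length+-++ : ∀ (xs : List A) j ys → drop (length xs + j) (xs ++ ys) ≡ drop j ys
drop-length+-++ []       j ys = refl
drop-length+-++ (x ∷ xs) j ys = drop-length+-++ xs j ys

take-length+-++ : ∀ (xs : List A) j ys → take (length xs + j) (xs ++ ys) ≡ xs ++ take j ys
take-length+-++ []       j ys = refl
take-length+-++ (x ∷ xs) j ys = cong (x ∷_) (take-length+-++ xs j ys)

replicate-++≡∷⇒suffix : ∀ n {a b : A} {xs ys zs} → a ≢ b →
                        replicate n a ++ ys ≡ xs ++ b ∷ zs → ∃[ us ] ys ≡ us ++ b ∷ zs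
replicate-++≡∷⇒suffix zero    {xs = xs}     _   eq = xs , eq
replicate-++≡∷⇒suffix (suc n) {xs = []}     a≢b eq = ⊥-elim (a≢b (∷-injectiveˡ eq))
replicate-++≡∷⇒suffix (suc n) {xs = _ ∷ xs} a≢b eq = replicate-++≡∷⇒suffix n a≢b (∷-injectiveʳ eq)

rotate-length+-++ : ∀ j (xs ys : Str) → rotate (length xs + j) (xs ++ ys) ≡ drop j ys ++ xs ++ take j ys
rotate-length+-++ j xs ys = cong₂ _++_ (drop-length+-++ xs j ys) (take-length+-++ xs j ys)

rotate-zeros+-++ : ∀ s j β → rotate (s + j) (zeros s ++ β) ≡ drop j β ++ zeros s ++ take j β
rotate-zeros+-++ s j β =
  subst (λ n → rotate (n + j) (zeros s ++ β) ≡ drop j β ++ zeros s ++ take j β)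
        (length-replicate s) (rotate-length+-++ j (zeros s) β)

reverse-zeros-++ : ∀ s β → reverse (zeros s ++ β) ≡ reverse β ++ zeros s
reverse-zeros-++ s β = trans (reverse-++ (zeros s) β) (cong (reverse β ++_) (reverse-replicate s false))

EndsWith1⇒BeginsWith1-reverse : ∀ {β} → EndsWith1 β → BeginsWith1 (reverse β)
EndsWith1⇒BeginsWith1-reverse (δ , refl) = reverse δ , reverse-++ δ [ true ]

BeginsWith1-++ : ∀ {β} γ → BeginsWith1 β → BeginsWith1 (β ++ γ)
BeginsWith1-++ γ (δ , refl) = δ ++ γ , refl

rotate-within-zeros⇒¬BeginsWith1 : ∀ {s k} β → k < s → ¬ BeginsWith1 (rotate k (zeros s ++ β))
rotate-within-zeros⇒¬BeginsWith1 {s} {k} β k<s (γ , eq) with drop-replicate-++ false β k<s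
... | ws , drop≡0ws with trans (sym eq) (cong (_++ take k (zeros s ++ β)) drop≡0ws)
... | ()

zeros-++≡1-zeros⇒SubstringOf : ∀ s β x y → zeros s ++ β ≡ x ++ true ∷ zeros s ++ y →
                               zeros s SubstringOf β
zeros-++≡1-zeros⇒SubstringOf s β x y eq with replicate-++≡∷⇒suffix s (λ ()) eq
... | us , β≡ = us ++ [ true ] , y , trans β≡ (sym (++-assoc us [ true ] (zeros s ++ y)))

reverse-++-zeros-++-∷ : ∀ s v u → reverse (v ++ zeros s ++ true ∷ u) ≡ reverse u ++ true ∷ zeros s ++ reverse v
reverse-++-zeros-++-∷ s v u = begin
  reverse (v ++ zeros s ++ true ∷ u)                    ≡⟨ reverse-++ v _ ⟩
  reverse (zeros s ++ true ∷ u) ++ reverse v            ≡⟨ cong (_++ reverse v) (reverse-zeros-++ s (true ∷ u)) ⟩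
  (reverse (true ∷ u) ++ zeros s) ++ reverse v          ≡⟨ cong (λ w → (w ++ zeros s) ++ reverse v) (unfold-reverse true u) ⟩
  ((reverse u ++ [ true ]) ++ zeros s) ++ reverse v     ≡⟨ ++-assoc (reverse u ++ [ true ]) (zeros s) (reverse v) ⟩
  (reverse u ++ [ true ]) ++ zeros s ++ reverse v       ≡⟨ ++-assoc (reverse u) [ true ] (zeros s ++ reverse v) ⟩
  reverse u ++ true ∷ zeros s ++ reverse v              ∎

reverse≡rotate-past-zeros⇒SubstringOf : ∀ s m β → BeginsWith1 β →
  reverse β ++ zeros s ≡ rotate (s + suc m) (zeros s ++ β) → zeros s SubstringOf β
reverse≡rotate-past-zeros⇒SubstringOf s m β (γ , refl) eq =
  zeros-++≡1-zeros⇒SubstringOf s β (reverse (take m γ)) (reverse v) (begin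
    zeros s ++ β                                     ≡⟨ sym (reverse-involutive (zeros s ++ β)) ⟩
    reverse (reverse (zeros s ++ β))                 ≡⟨ cong reverse (reverse-zeros-++ s β) ⟩
    reverse (reverse β ++ zeros s)                   ≡⟨ cong reverse (trans eq (rotate-zeros+-++ s (suc m) β)) ⟩
    reverse (v ++ zeros s ++ true ∷ take m γ)        ≡⟨ reverse-++-zeros-++-∷ s v (take m γ) ⟩
    reverse (take m γ) ++ true ∷ zeros s ++ reverse v ∎)
  where
  v = drop m γ

corollary1 : (s : ℕ) → s ≥ 1 → (β : Str) →
    Bracelet (zeros s ++ β) → SymmetricNecklace (zeros s ++ β) →
    BeginsWith1 β → EndsWith1 β → ¬ (zeros s SubstringOf β) →
    β ≡ reverse β
corollary1 s _ β _ (_ , k , _ , reverse≡rotate) β₁ βₑ 0ˢ⊈β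
  with k <? s | trans (sym (reverse-zeros-++ s β)) reverse≡rotate
... | yes k<s | eq = ⊥-elim (rotate-within-zeros⇒¬BeginsWith1 β k<s
        (subst BeginsWith1 eq (BeginsWith1-++ (zeros s) (EndsWith1⇒BeginsWith1-reverse βₑ))))
... | no k≮s | eq with m≤n⇒∃[o]m+o≡n (≮⇒≥ k≮s)
...   | zero , refl = sym (++-cancelʳ (zeros s) (reverse β) β (begin
  reverse β ++ zeros s   ≡⟨ trans eq (rotate-zeros+-++ s 0 β) ⟩
  β ++ zeros s ++ []     ≡⟨ cong (β ++_) (++-identityʳ (zeros s)) ⟩
  β ++ zeros s           ∎))
...   | suc m , refl = ⊥-elim (0ˢ⊈β (reverse≡rotate-past-zeros⇒SubstringOf s m β β₁ eq))
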